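{- In conjunctive compound Node-Kayles under misère play, the set $\mathcal{L}$ of integers $n\ge 0$ such that the single path $P_n$ is a $\mathcal{P}$-position is $\mathcal{L}=\{1,2\}$.
   Context: For $n\ge 0$, $P_n$ denotes the path on $n$ vertices ($P_0$ is the empty graph). A Node-Kayles move on a path $P_k$ with $k\ge 1$ chooses a vertex and deletes it together with its neighbours. The possible results are: $P_0$ if $k\in\{1,2\}$; $P_0$ or $P_1$ if $k=3$; and, for $k\ge 4$, $P_{k-2}$, $P_{k-3}$, or two paths $P_i,P_j$ with $j\ge i\ge1$, $i+j=k-3$. Conjunctive compound Node-Kayles is played by two players who move alternately, starting from a single path. A position is a finite multiset of paths (components). A move consists in replacing every component simultaneously by the result of a Node-Kayles move on it; a split component yields two components. The game ends as soon as some component is the empty path $P_0$, since no move is then possible. Under misère play, the first player unable to move wins; equivalently, the player who made the last move loses. A position is a $\mathcal{P}$-position if the second player (the one not moving next) has a winning strategy, and an $\mathcal{N}$-position otherwise. -}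

module Defs where

open import Data.Nat using (ℕ; _+_; _∸_; _≤_)
open import Data.List using (List; []; _∷_; [_]; _++_)
open import Data.List.Membership.Propositional using (_∈_)
open import Data.Product using (∃; _×_)
open import Data.Sum using (_⊎_)
open import Relation.Nullary using (¬_)
open import Relation.Binary.PropositionalEquality using (_≡_)

-- A position is a finite multiset of paths, represented as a list of path
-- lengths (the order is irrelevant); the empty path P₀ is the entry 0.
Position : Set
Position = List ℕ

-- Node-Kayles moves on a single path P_k, listing the resulting components.
data PathMove : ℕ → List ℕ → Set where
  move1   : PathMove 1 [ 0 ]
  move2   : PathMove 2 [ 0 ]
  move3₀  : PathMove 3 [ 0 ]
  move3₁  : PathMove 3 [ 1 ]
  moveEnd : ∀ {k} → 4 ≤ k → PathMove k [ k ∸ 2 ]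
  moveIn  : ∀ {k} → 4 ≤ k → PathMove k [ k ∸ 3 ]
  moveSplit : ∀ {k i j} → 4 ≤ k → 1 ≤ i → i ≤ j → i + j ≡ k ∸ 3 →
              PathMove k (i ∷ j ∷ [])

data Move : Position → Position → Set where
  done : Move [] []
  step : ∀ {k ks r rs} → PathMove k r → Move ks rs → Move (k ∷ ks) (r ++ rs)

Terminal : Position → Set
Terminal p = 0 ∈ p

-- Misère outcome classes (player unable to move wins), defined inductively
-- by backward induction on the (finite) game tree.
mutual
  data IsN : Position → Set where
    n-terminal : ∀ {p} → Terminal p → IsN p
    n-move     : ∀ {p q} → ¬ Terminal p → Move p q → IsP q → IsN p

  data IsP : Position → Set where
    p-all : ∀ {p} → ¬ Terminal p → (∀ {q} → Move p q → IsN q) → IsP p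

-- A position containing a component P₁ or P₂ is a 𝒫-position as long as it is
-- not already over: every move turns that component into P₀ and ends the game,
-- so the player who moved loses. Conversely, from any longer path the player to
-- move can create such a component: P₃ → P₁, P₄ → P₂ and Pₖ → P₁ + Pₖ₋₄ for
-- k ≥ 5. Hence Pₙ is a 𝒫-position exactly for n ∈ {1, 2}.
module Submission where

open import Defs
open import Data.Nat using (ℕ; zero; suc; _+_; s≤s; z≤n)
open import Data.Nat.Properties using (≤-refl)
open import Data.List using ([]; _∷_; [_])
open import Data.List.Relation.Unary.Any using (Any; here; there)
open import Data.List.Membership.Propositional using (_∈_)
open import Data.List.Membership.Propositional.Properties using (∈-++⁺ˡ; ∈-++⁺ʳ)
open import Data.Sum using (_⊎_; inj₁; inj₂)
open import Data.Empty using (⊥; ⊥-elim)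
open import Relation.Nullary using (¬_)
open import Function.Bundles using (_⇔_; mk⇔)
open import Relation.Binary.PropositionalEquality using (_≡_; refl)

IsP⇒¬IsN : ∀ {p} → IsP p → ¬ IsN p
IsP⇒¬IsN (p-all nt _) (n-terminal t)   = nt t
IsP⇒¬IsN (p-all _ f)  (n-move _ m pq) = IsP⇒¬IsN pq (f m)

Short : ℕ → Set
Short k = k ≡ 1 ⊎ k ≡ 2

PathMove-short⇒0∈ : ∀ {k r} → Short k → PathMove k r → 0 ∈ r
PathMove-short⇒0∈ (inj₁ refl) move1                      = here refl
PathMove-short⇒0∈ (inj₁ refl) (moveEnd (s≤s ()))
PathMove-short⇒0∈ (inj₁ refl) (moveIn (s≤s ()))
PathMove-short⇒0∈ (inj₁ refl) (moveSplit (s≤s ()) _ _ _)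
PathMove-short⇒0∈ (inj₂ refl) move2                      = here refl
PathMove-short⇒0∈ (inj₂ refl) (moveEnd (s≤s (s≤s ())))
PathMove-short⇒0∈ (inj₂ refl) (moveIn (s≤s (s≤s ())))
PathMove-short⇒0∈ (inj₂ refl) (moveSplit (s≤s (s≤s ())) _ _ _)

Move-short⇒Terminal : ∀ {p q} → Any Short p → Move p q → Terminal q
Move-short⇒Terminal (here s)  (step pm _)        = ∈-++⁺ˡ (PathMove-short⇒0∈ s pm)
Move-short⇒Terminal (there a) (step {r = r} _ m) = ∈-++⁺ʳ r (Move-short⇒Terminal a m)

IsP-short : ∀ {p} → ¬ Terminal p → Any Short p → IsP p
IsP-short nt a = p-all nt (λ m → n-terminal (Move-short⇒Terminal a m))

¬Terminal-[suc] : ∀ {n} → ¬ Terminal [ suc n ]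
¬Terminal-[suc] (here ())
¬Terminal-[suc] (there ())

¬Terminal-[1,suc] : ∀ {n} → ¬ Terminal (1 ∷ suc n ∷ [])
¬Terminal-[1,suc] (here ())
¬Terminal-[1,suc] (there (here ()))
¬Terminal-[1,suc] (there (there ()))

IsP-[1] : IsP [ 1 ]
IsP-[1] = IsP-short ¬Terminal-[suc] (here (inj₁ refl))

IsP-[2] : IsP [ 2 ]
IsP-[2] = IsP-short ¬Terminal-[suc] (here (inj₂ refl))

IsP-[1,suc] : ∀ n → IsP (1 ∷ suc n ∷ [])
IsP-[1,suc] n = IsP-short ¬Terminal-[1,suc] (here (inj₁ refl))

IsN-[3+] : ∀ n → IsN [ 3 + n ]
IsN-[3+] zero          = n-move ¬Terminal-[suc] (step move3₁ done) IsP-[1]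
IsN-[3+] (suc zero)    = n-move ¬Terminal-[suc] (step (moveEnd ≤-refl) done) IsP-[2]
IsN-[3+] (suc (suc n)) = n-move ¬Terminal-[suc] (step split-off-P₁ done) (IsP-[1,suc] n)
  where
  split-off-P₁ : PathMove (5 + n) (1 ∷ suc n ∷ [])
  split-off-P₁ = moveSplit (s≤s (s≤s (s≤s (s≤s z≤n)))) (s≤s z≤n) (s≤s z≤n) refl

corollary3 : (n : ℕ) → IsP [ n ] ⇔ (n ≡ 1 ⊎ n ≡ 2)
corollary3 n = mk⇔ (to n) from
  where
  to : ∀ n → IsP [ n ] → n ≡ 1 ⊎ n ≡ 2
  to zero                (p-all nt _) = ⊥-elim (nt (here refl))
  to (suc zero)          _            = inj₁ refl
  to (suc (suc zero))    _            = inj₂ refl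
  to (suc (suc (suc n))) isP          = ⊥-elim (IsP⇒¬IsN isP (IsN-[3+] n))

  from : ∀ {n} → n ≡ 1 ⊎ n ≡ 2 → IsP [ n ]
  from (inj₁ refl) = IsP-[1]
  from (inj₂ refl) = IsP-[2]
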